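{- For every $n\ge 2$, no orientation of the path $P_n$ induced by a $p_2$-configuration contains a flat edge incident with a leaf; that is, $e_1$ and $e_{n-1}$ are directed.
   Context: Parallel Diffusion on a finite simple graph $G$: a configuration assigns an integer stack size $|v|$ (possibly negative) to each vertex. In one step all vertices fire simultaneously: each vertex sends one chip to each neighbour with strictly smaller stack size. Starting from $C_0$, $C_{t+1}$ is obtained from $C_t$ by one step. A configuration $D$ is a $p_2$-configuration if there are $C_0$ and $N$ such that $C_{t+2}=C_t$ and $C_{t+1}\ne C_t$ for all $t\ge N$, and $D=C_t$ for some $t\ge N$. The path $P_n$ has vertices $v_1,\dots,v_n$ and edges $e_i=v_iv_{i+1}$. A configuration induces the orientation in which each edge is directed from its endpoint with larger stack size to its endpoint with smaller stack size, and is flat if the stack sizes are equal. -}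

module Defs where

open import Data.Nat as ℕ using (ℕ; zero; suc)
open import Data.Fin using (Fin; toℕ)
open import Data.Integer as ℤ using (ℤ; 0ℤ; 1ℤ; -1ℤ)
open import Data.List using (List; map; foldr)
open import Data.Product using (∃; _×_; _,_)
open import Relation.Nullary using (¬_; Dec; yes; no)
open import Relation.Binary.PropositionalEquality using (_≡_)
open import Data.List using (allFin) public

-- A configuration on a graph with vertex set Fin n: an integer stack size per vertex.
Config : ℕ → Set
Config n = Fin n → ℤ

_≈C_ : ∀ {n} → Config n → Config n → Set
C ≈C D = ∀ v → C v ≡ D v

-- Adjacency of the path P_n on vertices Fin n (v_{i+1} is index i):
-- i and j are adjacent iff they are consecutive.
PathAdj : ∀ {n} → Fin n → Fin n → Set
PathAdj i j = (toℕ j ≡ suc (toℕ i)) ⊎' (toℕ i ≡ suc (toℕ j))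
  where
  open import Data.Sum using () renaming (_⊎_ to _⊎'_)

pathAdj? : ∀ {n} (i j : Fin n) → Dec (PathAdj i j)
pathAdj? i j = (toℕ j ℕ.≟ suc (toℕ i)) ⊎-dec (toℕ i ℕ.≟ suc (toℕ j))
  where
  open import Relation.Nullary.Decidable using (_⊎-dec_)

-- Net change at v due to neighbour u: u sends one chip to v if |u| > |v|,
-- v sends one chip to u if |v| > |u|, nothing if equal.
flow : ℤ → ℤ → ℤ
flow cv cu with cv ℤ.<? cu
... | yes _ = 1ℤ
... | no _ with cu ℤ.<? cv
...   | yes _ = -1ℤ
...   | no _ = 0ℤ

stepG : ∀ {n} {Adj : Fin n → Fin n → Set} →
        (∀ i j → Dec (Adj i j)) → Config n → Config n
stepG {n} adj? C v = C v ℤ.+ foldr ℤ._+_ 0ℤ (map contrib (allFin n))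
  where
  contrib : Fin n → ℤ
  contrib u with adj? v u
  ... | yes _ = flow (C v) (C u)
  ... | no _ = 0ℤ

step : ∀ {n} → Config n → Config n
step = stepG pathAdj?

iter : ∀ {n} → ℕ → Config n → Config n
iter zero C = C
iter (suc t) C = step (iter t C)

IsP2 : ∀ {n} → Config n → Set
IsP2 {n} D =
  ∃ λ (C₀ : Config n) → ∃ λ (N : ℕ) →
    (∀ t → N ℕ.≤ t →
       (iter (suc (suc t)) C₀ ≈C iter t C₀) × ¬ (iter (suc t) C₀ ≈C iter t C₀))
    × (∃ λ t → N ℕ.≤ t × (D ≈C iter t C₀))

-- Suppose a p₂-configuration D = Cₜ has a flat leaf edge b b', and let X = Cₜ, Y = Cₜ₊₁, so that
-- X and Y are swapped by one step. The leaf b only sees b', so it does not fire: X b = Y b = c.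
-- Now walk away from b along the path. If X and Y are both c at a vertex v and at all its
-- neighbours but the next one w, then the net flow into v in either configuration is the single
-- term flow (c, X w), resp. flow (c, Y w); since v keeps the value c it vanishes, so X w = Y w = c.
-- Hence X = Y, i.e. the configuration is fixed rather than of period 2. The far leaf reduces
-- to the near one because reversing the path is a graph automorphism.
module Submission where

open import Defs
open import Data.Nat using (ℕ; suc)
open import Data.Fin using (zero; suc; fromℕ; inject₁)
open import Data.Product using (_×_)
open import Relation.Nullary using (¬_)
open import Relation.Binary.PropositionalEquality using (_≡_)

open import Data.Nat as ℕ using (zero; _≤_; _<_; _∸_; s≤s)
import Data.Nat.Properties as ℕ
open import Data.Nat.Induction using (<-rec)
open import Data.Fin using (Fin; toℕ; opposite)
import Data.Fin.Properties as Fin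
open import Data.Integer as ℤ using (ℤ; 0ℤ; _+_)
import Data.Integer.Properties as ℤ
open import Algebra.Properties.AbelianGroup ℤ.+-0-abelianGroup using (identityʳ-unique)
open import Data.List using (foldr; map; tabulate; allFin)
import Data.List.Properties as List
open import Data.Product using (Σ; ∃-syntax; proj₁; proj₂; _,_)
open import Data.Sum using (inj₁; inj₂)
open import Relation.Nullary using (Dec; yes; no; contradiction)
open import Relation.Binary using (tri<; tri≈; tri>)
open import Relation.Binary.PropositionalEquality
  using (refl; sym; trans; cong; subst; _≢_; module ≡-Reasoning)
open import Function using (id; _∘_)

flow-refl : ∀ x → flow x x ≡ 0ℤ
flow-refl x with x ℤ.<? x
... | yes x<x = contradiction x<x (ℤ.<-irrefl refl)
... | no _ with x ℤ.<? x
...   | yes x<x = contradiction x<x (ℤ.<-irrefl refl)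
...   | no _ = refl

flow≡0⇒≡ : ∀ x y → flow x y ≡ 0ℤ → x ≡ y
flow≡0⇒≡ x y eq with x ℤ.<? y
flow≡0⇒≡ x y () | yes _
... | no x≮y with y ℤ.<? x
flow≡0⇒≡ x y () | no _ | yes _
... | no y≮x with ℤ.<-cmp x y
... | tri< x<y _ _ = contradiction x<y x≮y
... | tri≈ _ x≡y _ = x≡y
... | tri> _ _ y<x = contradiction y<x y≮x

∑ : ∀ {n} → (Fin n → ℤ) → ℤ
∑ f = foldr _+_ 0ℤ (tabulate f)

∑-zero : ∀ {n} (f : Fin n → ℤ) → (∀ u → f u ≡ 0ℤ) → ∑ f ≡ 0ℤ
∑-zero {zero}  f f≡0 = refl
∑-zero {suc n} f f≡0 rewrite f≡0 zero | ∑-zero (f ∘ suc) (f≡0 ∘ suc) = refl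

∑-single : ∀ {n} (f : Fin n → ℤ) w → (∀ u → u ≢ w → f u ≡ 0ℤ) → ∑ f ≡ f w
∑-single {suc n} f zero f≡0
  rewrite ∑-zero (f ∘ suc) (λ u → f≡0 (suc u) λ ()) = ℤ.+-identityʳ (f zero)
∑-single {suc n} f (suc w) f≡0
  rewrite f≡0 zero (λ ())
        | ∑-single (f ∘ suc) w (λ u u≢w → f≡0 (suc u) (u≢w ∘ Fin.suc-injective))
  = ℤ.+-identityˡ (f (suc w))

module _ {n} (Adj : Fin n → Fin n → Set) where

  Leaf : Fin n → Fin n → Set
  Leaf b b' = Adj b b' × (∀ u → Adj b u → u ≡ b')

  -- An order in which a flat value spreads from the root b: the parent of a vertex of rank
  -- k + 1 has rank k and all its other neighbours have rank at most k.
  record Ranking (b : Fin n) : Set where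
    field
      rank : Fin n → ℕ
      rank≡0⇒root : ∀ i → rank i ≡ 0 → i ≡ b
      parent : ∀ w k → rank w ≡ suc k →
        ∃[ v ] rank v ≡ k × Adj v w × (∀ u → Adj v u → u ≢ w → rank u ≤ k)

module _ {n} (Adj : Fin n → Fin n → Set) (σ : Fin n → Fin n)
         (σ-involutive : ∀ i → σ (σ i) ≡ i)
         (σ-preserves-Adj : ∀ {i j} → Adj i j → Adj (σ i) (σ j)) where

  private
    σ-injective : ∀ {i j} → σ i ≡ σ j → i ≡ j
    σ-injective {i} {j} σi≡σj =
      trans (sym (σ-involutive i)) (trans (cong σ σi≡σj) (σ-involutive j))

    σ-moveˡ : ∀ {i j} → Adj (σ i) j → Adj i (σ j)
    σ-moveˡ {i} {j} a = subst (λ x → Adj x (σ j)) (σ-involutive i) (σ-preserves-Adj a)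

    σ-moveʳ : ∀ {i j} → Adj i (σ j) → Adj (σ i) j
    σ-moveʳ {i} {j} a = subst (Adj (σ i)) (σ-involutive j) (σ-preserves-Adj a)

    σ-flip : ∀ {i j} → σ i ≡ j → i ≡ σ j
    σ-flip {i} σi≡j = trans (sym (σ-involutive i)) (cong σ σi≡j)

  Leaf-map : ∀ {b b'} → Leaf Adj b b' → Leaf Adj (σ b) (σ b')
  Leaf-map (b~b' , only-b') = σ-preserves-Adj b~b' , λ u σb~u → σ-flip (only-b' (σ u) (σ-moveˡ σb~u))

  Ranking-map : ∀ {b} → Ranking Adj b → Ranking Adj (σ b)
  Ranking-map ranking = record
    { rank = rank ∘ σ
    ; rank≡0⇒root = λ i rank≡0 → σ-flip (rank≡0⇒root (σ i) rank≡0)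
    ; parent = parent′
    }
    where
    open Ranking ranking
    parent′ : ∀ w k → rank (σ w) ≡ suc k →
      ∃[ v ] rank (σ v) ≡ k × Adj v w × (∀ u → Adj v u → u ≢ w → rank (σ u) ≤ k)
    parent′ w k rank≡ with parent (σ w) k rank≡
    ... | v , rank-v , v~σw , others =
      σ v , subst (λ x → rank x ≡ k) (sym (σ-involutive v)) rank-v , σ-moveʳ v~σw ,
      λ u σv~u u≢w → others (σ u) (σ-moveˡ σv~u) (u≢w ∘ σ-injective)

module _ {n} {Adj : Fin n → Fin n → Set} (adj? : ∀ i j → Dec (Adj i j)) where

  FlatExcept : Config n → Fin n → Fin n → Set
  FlatExcept C v w = ∀ u → Adj v u → u ≢ w → C u ≡ C v

  private
    -- Names the contribution function local to stepG, which Defs does not export.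
    contribution : ∀ C v → Σ (Fin n → ℤ) λ f → stepG adj? C v ≡ C v + foldr _+_ 0ℤ (map f (allFin n))
    contribution C v = _ , refl

  stepG-flatExcept : ∀ C {v w} → Adj v w → FlatExcept C v w → stepG adj? C v ≡ C v + flow (C v) (C w)
  stepG-flatExcept C {v} {w} v~w flat = begin
    stepG adj? C v                         ≡⟨ proj₂ (contribution C v) ⟩
    C v + foldr _+_ 0ℤ (map f (allFin n))  ≡⟨ cong (λ xs → C v + foldr _+_ 0ℤ xs) (List.map-tabulate id f) ⟩
    C v + ∑ f                              ≡⟨ cong (C v +_) (∑-single f w f-vanishes) ⟩
    C v + f w                              ≡⟨ cong (C v +_) f-w ⟩
    C v + flow (C v) (C w)                 ∎
    where
    open ≡-Reasoning
    f : Fin n → ℤ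
    f = proj₁ (contribution C v)
    f-vanishes : ∀ u → u ≢ w → f u ≡ 0ℤ
    f-vanishes u u≢w with adj? v u
    ... | yes v~u rewrite flat u v~u u≢w = flow-refl (C v)
    ... | no _ = refl
    f-w : f w ≡ flow (C v) (C w)
    f-w with adj? v w
    ... | yes _ = refl
    ... | no v≁w = contradiction v~w v≁w

  stepG-fixed⇒flat : ∀ C {v w} → Adj v w → FlatExcept C v w → stepG adj? C v ≡ C v → C v ≡ C w
  stepG-fixed⇒flat C {v} {w} v~w flat fixed =
    flow≡0⇒≡ (C v) (C w) (identityʳ-unique (C v) _ (trans (sym (stepG-flatExcept C v~w flat)) fixed))

  flat⇒stepG-fixed : ∀ C {v w} → Adj v w → FlatExcept C v w → C v ≡ C w → stepG adj? C v ≡ C v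
  flat⇒stepG-fixed C {v} {w} v~w flat v≡w = begin
    stepG adj? C v          ≡⟨ stepG-flatExcept C v~w flat ⟩
    C v + flow (C v) (C w)  ≡⟨ cong (λ x → C v + flow (C v) x) (sym v≡w) ⟩
    C v + flow (C v) (C v)  ≡⟨ cong (C v +_) (flow-refl (C v)) ⟩
    C v + 0ℤ                ≡⟨ ℤ.+-identityʳ (C v) ⟩
    C v                     ∎
    where open ≡-Reasoning

  two-cycle-flat-leaf⇒≈ : ∀ {X Y b b'} → stepG adj? X ≈C Y → stepG adj? Y ≈C X →
                          Leaf Adj b b' → Ranking Adj b → X b ≡ X b' → X ≈C Y
  two-cycle-flat-leaf⇒≈ {X} {Y} {b} {b'} X↦Y Y↦X (b~b' , only-b') ranking flat i =
    trans (proj₁ (constant (rank i) i refl)) (sym (proj₂ (constant (rank i) i refl)))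
    where
    open Ranking ranking
    c : ℤ
    c = X b

    Constant : ℕ → Set
    Constant k = ∀ i → rank i ≡ k → X i ≡ c × Y i ≡ c

    Y-root : Y b ≡ c
    Y-root = trans (sym (X↦Y b))
      (flat⇒stepG-fixed X b~b' (λ u b~u u≢b' → contradiction (only-b' u b~u) u≢b') flat)

    settles : ∀ C D {v w} → stepG adj? C ≈C D → Adj v w → FlatExcept C v w →
              C v ≡ c → D v ≡ c → C w ≡ c
    settles C D C↦D v~w flatC Cv≡c Dv≡c =
      trans (sym (stepG-fixed⇒flat C v~w flatC (trans (C↦D _) (trans Dv≡c (sym Cv≡c))))) Cv≡c

    spread : ∀ k → (∀ {j} → j < k → Constant j) → Constant k
    spread zero _ i rank≡0 rewrite rank≡0⇒root i rank≡0 = refl , Y-root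
    spread (suc k) ih w rank-w with parent w k rank-w
    ... | v , rank-v , v~w , others =
      settles X Y X↦Y v~w (λ u v~u u≢w → trans (proj₁ (below u v~u u≢w)) (sym Xv≡c)) Xv≡c Yv≡c ,
      settles Y X Y↦X v~w (λ u v~u u≢w → trans (proj₂ (below u v~u u≢w)) (sym Yv≡c)) Yv≡c Xv≡c
      where
      below : ∀ u → Adj v u → u ≢ w → X u ≡ c × Y u ≡ c
      below u v~u u≢w = ih (s≤s (others u v~u u≢w)) u refl
      Xv≡c : X v ≡ c
      Xv≡c = proj₁ (ih (ℕ.n<1+n k) v rank-v)
      Yv≡c : Y v ≡ c
      Yv≡c = proj₂ (ih (ℕ.n<1+n k) v rank-v)

    constant : ∀ k → Constant k
    constant = <-rec Constant spread

p2-leaf-directed : ∀ {n} {D : Config n} {b b'} →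
                   Leaf PathAdj b b' → Ranking PathAdj b → IsP2 D → D b ≢ D b'
p2-leaf-directed {b = b} {b'} leaf ranking (C₀ , N , periodic , t , N≤t , D≈Cₜ) D-flat =
  not-fixed (λ v → sym (two-cycle-flat-leaf⇒≈ pathAdj? (λ _ → refl) returns leaf ranking Cₜ-flat v))
  where
  Cₜ : Config _
  Cₜ = iter t C₀
  returns : step (step Cₜ) ≈C Cₜ
  returns = proj₁ (periodic t N≤t)
  not-fixed : ¬ (step Cₜ ≈C Cₜ)
  not-fixed = proj₂ (periodic t N≤t)
  Cₜ-flat : Cₜ b ≡ Cₜ b'
  Cₜ-flat = trans (sym (D≈Cₜ b)) (trans D-flat (D≈Cₜ b'))

toℕ-opposite-suc : ∀ {n} {i j : Fin n} → toℕ j ≡ suc (toℕ i) →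
                   toℕ (opposite i) ≡ suc (toℕ (opposite j))
toℕ-opposite-suc {n} {i} {j} j≡1+i = begin
  toℕ (opposite i)          ≡⟨ Fin.opposite-prop i ⟩
  n ∸ suc (toℕ i)           ≡⟨ cong (n ∸_) (sym j≡1+i) ⟩
  n ∸ toℕ j                 ≡⟨ ℕ.+-∸-assoc 1 (Fin.toℕ<n j) ⟩
  suc (n ∸ suc (toℕ j))     ≡⟨ cong suc (sym (Fin.opposite-prop j)) ⟩
  suc (toℕ (opposite j))    ∎
  where open ≡-Reasoning

PathAdj-opposite : ∀ {n} {i j : Fin n} → PathAdj i j → PathAdj (opposite i) (opposite j)
PathAdj-opposite (inj₁ j≡1+i) = inj₂ (toℕ-opposite-suc j≡1+i)
PathAdj-opposite (inj₂ i≡1+j) = inj₁ (toℕ-opposite-suc i≡1+j)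

first-leaf : ∀ {m} → Leaf (PathAdj {suc (suc m)}) zero (suc zero)
first-leaf = inj₁ refl , only-neighbour
  where
  only-neighbour : ∀ u → PathAdj zero u → u ≡ suc zero
  only-neighbour u (inj₁ u≡1) = Fin.toℕ-injective u≡1
  only-neighbour u (inj₂ ())

toℕ-ranking : ∀ {n} → Ranking (PathAdj {suc n}) zero
toℕ-ranking = record { rank = toℕ ; rank≡0⇒root = toℕ≡0⇒zero ; parent = parent }
  where
  toℕ≡0⇒zero : ∀ {n} (i : Fin (suc n)) → toℕ i ≡ 0 → i ≡ zero
  toℕ≡0⇒zero zero _ = refl
  toℕ≡0⇒zero (suc i) ()

  parent : ∀ {n} (w : Fin (suc n)) k → toℕ w ≡ suc k →
    ∃[ v ] toℕ v ≡ k × PathAdj v w × (∀ u → PathAdj v u → u ≢ w → toℕ u ≤ k)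
  parent (suc w) k 1+w≡1+k = inject₁ w , w′≡k , inj₁ (cong suc (sym (Fin.toℕ-inject₁ w))) , others
    where
    w′≡k : toℕ (inject₁ w) ≡ k
    w′≡k = trans (Fin.toℕ-inject₁ w) (ℕ.suc-injective 1+w≡1+k)
    others : ∀ u → PathAdj (inject₁ w) u → u ≢ suc w → toℕ u ≤ k
    others u (inj₁ u≡1+w′) u≢1+w =
      contradiction (Fin.toℕ-injective (trans u≡1+w′ (cong suc (Fin.toℕ-inject₁ w)))) u≢1+w
    others u (inj₂ w′≡1+u) _ = ℕ.<⇒≤ (ℕ.≤-reflexive (trans (sym w′≡1+u) w′≡k))

-- opposite sends zero and suc zero to fromℕ (suc m) and inject₁ (fromℕ m) by computation.
last-leaf : ∀ {m} → Leaf (PathAdj {suc (suc m)}) (fromℕ (suc m)) (inject₁ (fromℕ m))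
last-leaf = Leaf-map PathAdj opposite Fin.opposite-involutive PathAdj-opposite first-leaf

opposite-ranking : ∀ {n} → Ranking (PathAdj {suc n}) (fromℕ n)
opposite-ranking = Ranking-map PathAdj opposite Fin.opposite-involutive PathAdj-opposite toℕ-ranking

lemma2p2 : (m : ℕ) (D : Config (suc (suc m))) → IsP2 D →
    ¬ (D zero ≡ D (suc zero)) × ¬ (D (inject₁ (fromℕ m)) ≡ D (fromℕ (suc m)))
lemma2p2 m D p2 =
  p2-leaf-directed first-leaf toℕ-ranking p2 ,
  p2-leaf-directed last-leaf opposite-ranking p2 ∘ sym
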